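{- (i) For all $M\in\mathcal{B}$, $\tilde M\in\tilde{\mathcal{B}}$ and $\ell\in\mathbb{Z}$ one has $MA^\ell\in\mathcal{B}$ and $\tilde MA^\ell\in\tilde{\mathcal{B}}$; thus $\mathbb{Z}\cong\langle A\rangle$ acts on $\mathcal{B}$ and $\tilde{\mathcal{B}}$ by right multiplication. (ii) The assignment $\Big[\begin{pmatrix}a&b\\c&d\end{pmatrix}\Big]\mapsto[(c,d)]$ defines $\mathbb{Z}$-equivariant bijections $\mathcal{B}\to\mathcal{P}/\mathbb{Z}^\times$ and $\tilde{\mathcal{B}}\to\tilde{\mathcal{P}}/\mathbb{Z}^\times$.
   Context: $S=\begin{pmatrix}0&-1\\1&0\end{pmatrix}$, $T=\begin{pmatrix}1&1\\0&1\end{pmatrix}$; $[M]$ denotes the image in $\mathrm{PSL}_2(\mathbb{Z})$; $\bar S=[S]$, $A=[T^2]$, $B=[ST^2S]$; $A,B$ freely generate the image of $\Gamma(2)=\ker(\mathrm{SL}_2(\mathbb{Z})\to\mathrm{SL}_2(\mathbb{Z}/2\mathbb{Z}))$ in $\mathrm{PSL}_2(\mathbb{Z})$. $\mathcal{B}$ is the set of elements $B^{f_1}A^{e_1}\cdots B^{f_m}A^{e_m}$ with $m\ge1$ and integers $e_i,f_i$ all nonzero except possibly $e_m$; $\tilde{\mathcal{B}}=\{M\bar S:M\in\mathcal{B}\}\cup\{\bar S\}$. $\mathcal{P}=\{(c,d)\in\mathbb{Z}^2:\gcd(c,d)=1,\ c\equiv0,\ d\equiv1\pmod2,\ c\ne0\}$,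 $\tilde{\mathcal{P}}=\{(c,d)\in\mathbb{Z}^2:\gcd(c,d)=1,\ c\equiv1,\ d\equiv0\pmod2\}$. $\mathbb{Z}^\times=\{\pm1\}$ acts by $\varepsilon\cdot(c,d)=(\varepsilon c,\varepsilon d)$, with classes $[(c,d)]=\{(c,d),(-c,-d)\}$; $\mathbb{Z}$ acts on these sets by $(c,d)|\ell=(c,d+2\ell c)$ (commuting with the $\mathbb{Z}^\times$-action, hence acting on the quotients), and on $\mathcal{B},\tilde{\mathcal{B}}$ by $M\mapsto MA^\ell$. -}

module Defs where

open import Data.Nat using (ℕ; zero; suc)
open import Data.Integer using (ℤ; +_; -[1+_]; _+_; _*_; -_; _-_; 0ℤ; 1ℤ)
open import Data.Integer.GCD using (gcd)
open import Data.Integer.Divisibility using (_∣_)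
open import Data.Product using (Σ; ∃; _×_; _,_)
open import Data.Sum using (_⊎_)
open import Relation.Nullary using (¬_)
open import Relation.Binary.PropositionalEquality using (_≡_; _≢_)

record Mat : Set where
  constructor mat
  field
    a b c d : ℤ
open Mat public

_·_ : Mat → Mat → Mat
mat a₁ b₁ c₁ d₁ · mat a₂ b₂ c₂ d₂ =
  mat (a₁ * a₂ + b₁ * c₂) (a₁ * b₂ + b₁ * d₂) (c₁ * a₂ + d₁ * c₂) (c₁ * b₂ + d₁ * d₂)
infixl 7 _·_

I : Mat
I = mat 1ℤ 0ℤ 0ℤ 1ℤ

negM : Mat → Mat
negM (mat a b c d) = mat (- a) (- b) (- c) (- d)

-- adjugate; this is the inverse for matrices of determinant 1 (all matrices used here)
adj : Mat → Mat
adj (mat a b c d) = mat d (- b) (- c) a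

powℕ : Mat → ℕ → Mat
powℕ M zero = I
powℕ M (suc n) = M · powℕ M n

_^ℤ_ : Mat → ℤ → Mat
M ^ℤ (+ n) = powℕ M n
M ^ℤ -[1+ n ] = powℕ (adj M) (suc n)

S T : Mat
S = mat 0ℤ (- 1ℤ) 1ℤ 0ℤ
T = mat 1ℤ 1ℤ 0ℤ 1ℤ

-- representatives in SL₂(ℤ) of A = [T²] and B = [S T² S]
Am Bm : Mat
Am = T · T
Bm = S · T · T · S

-- equality in PSL₂(ℤ): M ≈ N iff M = ±N
_≈P_ : Mat → Mat → Set
M ≈P N = (M ≡ N) ⊎ (M ≡ negM N)

-- words B^{f₁}A^{e₁}⋯B^{f_m}A^{e_m}, m ≥ 1, all exponents nonzero except possibly e_m
data BWord : Set where
  lastW : (f e : ℤ) → f ≢ 0ℤ → BWord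
  consW : (f e : ℤ) → f ≢ 0ℤ → e ≢ 0ℤ → BWord → BWord

evalW : BWord → Mat
evalW (lastW f e _) = (Bm ^ℤ f) · (Am ^ℤ e)
evalW (consW f e _ _ w) = (Bm ^ℤ f) · (Am ^ℤ e) · evalW w

InB : Mat → Set
InB M = Σ BWord λ w → M ≈P evalW w

InBt : Mat → Set
InBt M = (Σ BWord λ w → M ≈P (evalW w · S)) ⊎ (M ≈P S)

Pair : Set
Pair = ℤ × ℤ

InP : Pair → Set
InP (c , d) = (gcd c d ≡ 1ℤ) × ((+ 2) ∣ c) × (¬ ((+ 2) ∣ d)) × (c ≢ 0ℤ)

InPt : Pair → Set
InPt (c , d) = (gcd c d ≡ 1ℤ) × (¬ ((+ 2) ∣ c)) × ((+ 2) ∣ d)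

-- equality of classes in (pairs)/ℤ^× : (c,d) ~ ±(c',d')
_≈±_ : Pair → Pair → Set
(c , d) ≈± (c' , d') = ((c , d) ≡ (c' , d')) ⊎ ((c , d) ≡ (- c' , - d'))

_∣act_ : Pair → ℤ → Pair
(c , d) ∣act ℓ = (c , d + (+ 2) * ℓ * c)

bottom : Mat → Pair
bottom M = (c M , d M)

{-# OPTIONS --safe #-}
module Submission where

-- The bottom row (c , d) of a word M in A and B evolves letter by letter: B^f replaces c by
-- c - 2fd and A^e replaces d by d + 2ec. Starting from (0 , 1) with nonzero exponents, each
-- letter makes the coordinate it changes strictly larger in absolute value than the other one
-- (ping-pong), so the last two exponents, and then the whole reduced word, can be read off from
-- ±(c , d): the map is injective. Conversely, for c even and d odd, shifting d into (-|c|, |c|)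
-- and then c into (-|d|, |d|) is possible (strictly, because the parities differ) and strictly
-- decreases |c|; this Euclidean descent ends at (0 , ±1) and spells out a reduced word. For 𝓑̃,
-- right multiplication by S turns (c , d) into (d , -c), and since S A^ℓ = B^ℓ S the action of
-- A^ℓ is absorbed into the last B-exponent.

open import Data.Empty using (⊥-elim)
open import Data.Integer using (ℤ; +_; -[1+_]; _+_; _*_; -_; _-_; _⊖_; 0ℤ; 1ℤ; ∣_∣)
open import Data.Integer.Divisibility.Signed
  using (_∣_; divides; ∣ᵤ⇒∣; ∣⇒∣ᵤ; ∣-refl; ∣m∣n⇒∣m+n; ∣m∣n⇒∣m-n; ∣m+n∣n⇒∣m; ∣m⇒∣-m; ∣n⇒∣m*n; ∣m⇒∣m*n)
open import Data.Integer.DivMod using (_%ℕ_; _/ℕ_; a≡a%ℕn+[a/ℕn]*n; n%ℕd<d)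
open import Data.Integer.GCD using (gcd; gcd[i,j]∣i; gcd[i,j]∣j; gcd-greatest; gcd-comm)
import Data.Integer.Properties as ℤ
open import Data.Integer.Tactic.RingSolver using (solve-∀)
open import Data.Nat.Base as ℕ using (zero; suc)
import Data.Nat.Divisibility as ℕ∣
import Data.Nat.GCD as ℕ using (gcd)
import Data.Nat.Properties as ℕ
open import Data.Product using (Σ; ∃-syntax; _×_; _,_; proj₁; proj₂; map₂)
open import Data.Product.Properties using (,-injectiveˡ; ,-injectiveʳ)
open import Data.Sum using (_⊎_; inj₁; inj₂)
open import Data.Unit using (⊤; tt)
open import Function using (_∘_; id)
open import Level using (0ℓ)
open import Relation.Binary.Bundles using (Setoid)
open import Relation.Binary.PropositionalEquality
import Relation.Binary.Reasoning.Setoid as SetoidReasoning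
open import Relation.Nullary using (¬_; yes; no)

open import Defs

_≈[_]_ : {A : Set} → A → (A → A) → A → Set
x ≈[ neg ] y = x ≡ y ⊎ x ≡ neg y

module UpToSign {A : Set} {neg : A → A} (neg-involutive : ∀ x → neg (neg x) ≡ x) where

  ≈-sym : ∀ {x y} → x ≈[ neg ] y → y ≈[ neg ] x
  ≈-sym (inj₁ refl) = inj₁ refl
  ≈-sym {y = y} (inj₂ refl) = inj₂ (sym (neg-involutive y))

  ≈-trans : ∀ {x y z} → x ≈[ neg ] y → y ≈[ neg ] z → x ≈[ neg ] z
  ≈-trans (inj₁ refl) y≈z = y≈z
  ≈-trans (inj₂ refl) (inj₁ refl) = inj₂ refl
  ≈-trans (inj₂ refl) (inj₂ refl) = inj₁ (neg-involutive _)

  ≈-setoid : Setoid 0ℓ 0ℓ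
  ≈-setoid = record
    { Carrier = A
    ; _≈_ = _≈[ neg ]_
    ; isEquivalence = record { refl = inj₁ refl ; sym = ≈-sym ; trans = ≈-trans }
    }

map-≈ : ∀ {A B : Set} (negA : A → A) (negB : B → B) (f : A → B) →
        (∀ x → f (negA x) ≡ negB (f x)) →
        ∀ {x y} → x ≈[ negA ] y → f x ≈[ negB ] f y
map-≈ _ _ f f-neg (inj₁ refl) = inj₁ refl
map-≈ _ _ f f-neg {y = y} (inj₂ refl) = inj₂ (f-neg y)

-- 2×2 integer matrices up to sign

mat-cong : ∀ {a b c d a′ b′ c′ d′} → a ≡ a′ → b ≡ b′ → c ≡ c′ → d ≡ d′ →
           mat a b c d ≡ mat a′ b′ c′ d′
mat-cong refl refl refl refl = refl

·-assoc : ∀ X Y Z → (X · Y) · Z ≡ X · (Y · Z)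
·-assoc (mat a b c d) (mat e f g h) (mat i j k l) =
  mat-cong (entry a b e f g h i k) (entry a b e f g h j l) (entry c d e f g h i k) (entry c d e f g h j l)
  where
  entry : ∀ a b e f g h i k →
          (a * e + b * g) * i + (a * f + b * h) * k ≡ a * (e * i + f * k) + b * (g * i + h * k)
  entry = solve-∀

·-assoc₄ : ∀ W X Y Z → W · X · Y · Z ≡ W · (X · Y · Z)
·-assoc₄ W X Y Z = begin
  W · X · Y · Z        ≡⟨ ·-assoc (W · X) Y Z ⟩
  W · X · (Y · Z)      ≡⟨ ·-assoc W X (Y · Z) ⟩
  W · (X · (Y · Z))    ≡⟨ cong (W ·_) (·-assoc X Y Z) ⟨
  W · (X · Y · Z)      ∎
  where open ≡-Reasoning

·-identityˡ : ∀ X → I · X ≡ X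
·-identityˡ (mat a b c d) = mat-cong (first a c) (first b d) (second a c) (second b d)
  where
  first : ∀ x y → 1ℤ * x + 0ℤ * y ≡ x
  first = solve-∀
  second : ∀ x y → 0ℤ * x + 1ℤ * y ≡ y
  second = solve-∀

·-identityʳ : ∀ X → X · I ≡ X
·-identityʳ (mat a b c d) = mat-cong (first a b) (second a b) (first c d) (second c d)
  where
  first : ∀ x y → x * 1ℤ + y * 0ℤ ≡ x
  first = solve-∀
  second : ∀ x y → x * 0ℤ + y * 1ℤ ≡ y
  second = solve-∀

negM-involutive : ∀ X → negM (negM X) ≡ X
negM-involutive (mat a b c d) =
  mat-cong (ℤ.neg-involutive a) (ℤ.neg-involutive b) (ℤ.neg-involutive c) (ℤ.neg-involutive d)

negM-distribˡ-· : ∀ X Y → negM X · Y ≡ negM (X · Y)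
negM-distribˡ-· (mat a b c d) (mat e f g h) =
  mat-cong (entry a b e g) (entry a b f h) (entry c d e g) (entry c d f h)
  where
  entry : ∀ a b e g → (- a) * e + (- b) * g ≡ - (a * e + b * g)
  entry = solve-∀

negM-distribʳ-· : ∀ X Y → X · negM Y ≡ negM (X · Y)
negM-distribʳ-· (mat a b c d) (mat e f g h) =
  mat-cong (entry a b e g) (entry a b f h) (entry c d e g) (entry c d f h)
  where
  entry : ∀ a b e g → a * (- e) + b * (- g) ≡ - (a * e + b * g)
  entry = solve-∀

open UpToSign {neg = negM} negM-involutive public using ()
  renaming (≈-sym to ≈P-sym; ≈-trans to ≈P-trans; ≈-setoid to ≈P-setoid)

module ≈P-Reasoning = SetoidReasoning ≈P-setoid

·-congˡ : ∀ {X X′} Y → X ≈P X′ → (X · Y) ≈P (X′ · Y)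
·-congˡ Y = map-≈ negM negM (_· Y) (λ X → negM-distribˡ-· X Y)

·-congʳ : ∀ X {Y Y′} → Y ≈P Y′ → (X · Y) ≈P (X · Y′)
·-congʳ X = map-≈ negM negM (X ·_) (negM-distribʳ-· X)

det : Mat → ℤ
det (mat a b c d) = a * d - b * c

det-· : ∀ X Y → det (X · Y) ≡ det X * det Y
det-· (mat a b c d) (mat e f g h) = expand a b c d e f g h
  where
  expand : ∀ a b c d e f g h →
           (a * e + b * g) * (c * f + d * h) - (a * f + b * h) * (c * e + d * g)
             ≡ (a * d - b * c) * (e * h - f * g)
  expand = solve-∀

det-negM : ∀ X → det (negM X) ≡ det X
det-negM (mat a b c d) = expand a b c d
  where
  expand : ∀ a b c d → (- a) * (- d) - (- b) * (- c) ≡ a * d - b * c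
  expand = solve-∀

det-cong : ∀ {X Y} → X ≈P Y → det X ≡ det Y
det-cong (inj₁ refl) = refl
det-cong {Y = Y} (inj₂ refl) = det-negM Y

det≡1⇒gcd[c,d]≡1 : ∀ M → det M ≡ 1ℤ → gcd (c M) (d M) ≡ 1ℤ
det≡1⇒gcd[c,d]≡1 (mat a b c d) det≡1 = cong +_ (ℕ∣.∣1⇒≡1 (∣⇒∣ᵤ (subst (gcd c d ∣_) det≡1 g∣det)))
  where
  g∣det : gcd c d ∣ a * d - b * c
  g∣det = ∣m∣n⇒∣m-n (∣n⇒∣m*n a (∣ᵤ⇒∣ (gcd[i,j]∣j c d))) (∣n⇒∣m*n b (∣ᵤ⇒∣ (gcd[i,j]∣i c d)))

infix 30 A^_ B^_

-- Representatives with diagonal 1: Bm itself is negM (B^ 1ℤ), so Bm ^ℤ f is B^ f only up to sign.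
A^_ B^_ : ℤ → Mat
A^ e = mat 1ℤ (+ 2 * e) 0ℤ 1ℤ
B^ f = mat 1ℤ 0ℤ (+ 2 * - f) 1ℤ

A^-+ : ∀ a b → A^ a · A^ b ≡ A^ (a + b)
A^-+ a b = mat-cong (one a) (entry a b) refl (one′ b)
  where
  one : ∀ a → 1ℤ * 1ℤ + (+ 2 * a) * 0ℤ ≡ 1ℤ
  one = solve-∀
  one′ : ∀ b → 0ℤ * (+ 2 * b) + 1ℤ * 1ℤ ≡ 1ℤ
  one′ = solve-∀
  entry : ∀ a b → 1ℤ * (+ 2 * b) + (+ 2 * a) * 1ℤ ≡ + 2 * (a + b)
  entry = solve-∀

B^-+ : ∀ a b → B^ a · B^ b ≡ B^ (a + b)
B^-+ a b = mat-cong (one b) refl (entry a b) (one′ a)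
  where
  one : ∀ b → 1ℤ * 1ℤ + 0ℤ * (+ 2 * - b) ≡ 1ℤ
  one = solve-∀
  one′ : ∀ a → (+ 2 * - a) * 0ℤ + 1ℤ * 1ℤ ≡ 1ℤ
  one′ = solve-∀
  entry : ∀ a b → (+ 2 * - a) * 1ℤ + 1ℤ * (+ 2 * - b) ≡ + 2 * - (a + b)
  entry = solve-∀

module _ (F : ℤ → Mat) (F-+ : ∀ a b → F a · F b ≡ F (a + b)) (F-0 : F 0ℤ ≡ I) where

  powℕ-hom : ∀ k n → powℕ (F k) n ≡ F (+ n * k)
  powℕ-hom k zero = sym (trans (cong F (ℤ.*-zeroˡ k)) F-0)
  powℕ-hom k (suc n) = begin
    F k · powℕ (F k) n  ≡⟨ cong (F k ·_) (powℕ-hom k n) ⟩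
    F k · F (+ n * k)   ≡⟨ F-+ k (+ n * k) ⟩
    F (k + + n * k)     ≡⟨ cong F (suc-* k (+ n)) ⟩
    F (+ suc n * k)     ∎
    where
    open ≡-Reasoning
    suc-* : ∀ k x → k + x * k ≡ (1ℤ + x) * k
    suc-* = solve-∀

  ^ℤ-hom : adj (F 1ℤ) ≡ F (- 1ℤ) → ∀ e → F 1ℤ ^ℤ e ≡ F e
  ^ℤ-hom adj-F (+ n) = trans (powℕ-hom 1ℤ n) (cong F (ℤ.*-identityʳ (+ n)))
  ^ℤ-hom adj-F -[1+ n ] = begin
    powℕ (adj (F 1ℤ)) (suc n)  ≡⟨ cong (λ X → powℕ X (suc n)) adj-F ⟩
    powℕ (F (- 1ℤ)) (suc n)    ≡⟨ powℕ-hom (- 1ℤ) (suc n) ⟩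
    F (+ suc n * - 1ℤ)         ≡⟨ cong F (*-neg-one (+ suc n)) ⟩
    F -[1+ n ]                 ∎
    where
    open ≡-Reasoning
    *-neg-one : ∀ x → x * - 1ℤ ≡ - x
    *-neg-one = solve-∀

powℕ-negM : ∀ X n → powℕ (negM X) n ≈P powℕ X n
powℕ-negM X zero = inj₁ refl
powℕ-negM X (suc n) = ≈P-trans (·-congʳ (negM X) (powℕ-negM X n)) (inj₂ (negM-distribˡ-· X (powℕ X n)))

^ℤ-negM : ∀ X e → (negM X ^ℤ e) ≈P (X ^ℤ e)
^ℤ-negM X (+ n) = powℕ-negM X n
^ℤ-negM (mat a b c d) -[1+ n ] = powℕ-negM (adj (mat a b c d)) (suc n)

Am^ℤ≡A^ : ∀ e → Am ^ℤ e ≡ A^ e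
Am^ℤ≡A^ = ^ℤ-hom A^_ A^-+ refl refl

Bm^ℤ≈B^ : ∀ f → (Bm ^ℤ f) ≈P B^ f
Bm^ℤ≈B^ f = ≈P-trans (^ℤ-negM (B^ 1ℤ) f) (inj₁ (^ℤ-hom B^_ B^-+ refl refl f))

block-≈ : ∀ f e → ((Bm ^ℤ f) · (Am ^ℤ e)) ≈P (B^ f · A^ e)
block-≈ f e = ≈P-trans (·-congˡ (Am ^ℤ e) (Bm^ℤ≈B^ f)) (inj₁ (cong (B^ f ·_) (Am^ℤ≡A^ e)))

S·A^≡B^·S : ∀ ℓ → S · A^ ℓ ≡ B^ ℓ · S
S·A^≡B^·S ℓ = mat-cong refl (entry₂ ℓ) (entry₃ ℓ) (entry₄ ℓ)
  where
  entry₃ : ∀ ℓ → 1ℤ * 1ℤ + 0ℤ * 0ℤ ≡ (+ 2 * - ℓ) * 0ℤ + 1ℤ * 1ℤ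
  entry₃ = solve-∀
  entry₂ : ∀ ℓ → 0ℤ * (+ 2 * ℓ) + - 1ℤ * 1ℤ ≡ 1ℤ * - 1ℤ + 0ℤ * 0ℤ
  entry₂ = solve-∀
  entry₄ : ∀ ℓ → 1ℤ * (+ 2 * ℓ) + 0ℤ * 1ℤ ≡ (+ 2 * - ℓ) * - 1ℤ + 1ℤ * 0ℤ
  entry₄ = solve-∀

det-A^ : ∀ e → det (A^ e) ≡ 1ℤ
det-A^ e = expand e
  where
  expand : ∀ e → 1ℤ * 1ℤ - (+ 2 * e) * 0ℤ ≡ 1ℤ
  expand = solve-∀

det-B^ : ∀ f → det (B^ f) ≡ 1ℤ
det-B^ f = expand f
  where
  expand : ∀ f → 1ℤ * 1ℤ - 0ℤ * (+ 2 * - f) ≡ 1ℤ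
  expand = solve-∀

-- Parity and shifts by even multiples

Even Odd : ℤ → Set
Even z = + 2 ∣ z
Odd z = ¬ Even z

Even-neg : ∀ {z} → Even z → Even (- z)
Even-neg = ∣m⇒∣-m

Even-neg⁻ : ∀ {z} → Even (- z) → Even z
Even-neg⁻ {z} = subst Even (ℤ.neg-involutive z) ∘ ∣m⇒∣-m

Odd-neg : ∀ {z} → Odd z → Odd (- z)
Odd-neg odd = odd ∘ Even-neg⁻

Even-0 : Even 0ℤ
Even-0 = divides 0ℤ refl

Odd-1 : Odd 1ℤ
Odd-1 = (λ ()) ∘ ℕ∣.∣1⇒≡1 ∘ ∣⇒∣ᵤ

Odd⇒≢0 : ∀ {z} → Odd z → z ≢ 0ℤ
Odd⇒≢0 odd refl = odd Even-0

Even-2* : ∀ k x → Even (+ 2 * k * x)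
Even-2* k x = ∣m⇒∣m*n x (∣m⇒∣m*n k ∣-refl)

Even-shift : ∀ {y} k x → Even y → Even (y + + 2 * k * x)
Even-shift k x even = ∣m∣n⇒∣m+n even (Even-2* k x)

Even-shift⁻ : ∀ {y} k x → Even (y + + 2 * k * x) → Even y
Even-shift⁻ k x even = ∣m+n∣n⇒∣m even (Even-2* k x)

Odd-shift : ∀ {y} k x → Odd y → Odd (y + + 2 * k * x)
Odd-shift k x odd = odd ∘ Even-shift⁻ k x

Odd-shift⁻ : ∀ {y} k x → Odd (y + + 2 * k * x) → Odd y
Odd-shift⁻ k x odd = odd ∘ Even-shift k x

OppositeParity : ℤ → ℤ → Set
OppositeParity x y = (Even x × Odd y) ⊎ (Odd x × Even y)

∣i∣≡∣j∣⇒i≡±j : ∀ i j → ∣ i ∣ ≡ ∣ j ∣ → i ≡ j ⊎ i ≡ - j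
∣i∣≡∣j∣⇒i≡±j (+ m) (+ n) refl = inj₁ refl
∣i∣≡∣j∣⇒i≡±j (+ m) -[1+ n ] refl = inj₂ refl
∣i∣≡∣j∣⇒i≡±j -[1+ m ] (+ n) refl = inj₂ refl
∣i∣≡∣j∣⇒i≡±j -[1+ m ] -[1+ n ] refl = inj₁ refl

-- y + 2kx has the parity of y, and ±x that of x.
shift-∣∣≢ : ∀ {x y} → OppositeParity x y → ∀ k → ∣ y + + 2 * k * x ∣ ≢ ∣ x ∣
shift-∣∣≢ {x} {y} opposite k eq with opposite
... | inj₁ (even-x , odd-y) = odd-y (Even-shift⁻ k x (±-Even (∣i∣≡∣j∣⇒i≡±j _ x eq) even-x))
  where
  ±-Even : ∀ {w} → w ≡ x ⊎ w ≡ - x → Even x → Even w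
  ±-Even (inj₁ refl) = id
  ±-Even (inj₂ refl) = Even-neg
... | inj₂ (odd-x , even-y) = odd-x (±-Even⁻ (∣i∣≡∣j∣⇒i≡±j _ x eq) (Even-shift k x even-y))
  where
  ±-Even⁻ : ∀ {w} → w ≡ x ⊎ w ≡ - x → Even w → Even x
  ±-Even⁻ (inj₁ refl) = id
  ±-Even⁻ (inj₂ refl) = Even-neg⁻

shift-grows : ∀ x y k → ∣ x ∣ ℕ.< ∣ y ∣ → k ≢ 0ℤ → ∣ y ∣ ℕ.< ∣ x + + 2 * k * y ∣
shift-grows x y k ∣x∣<∣y∣ k≢0 = ℕ.+-cancelʳ-< _ _ _ (begin-strict
  ∣ y ∣ ℕ.+ ∣ y ∣                     ≡⟨ cong (∣ y ∣ ℕ.+_) (ℕ.+-identityʳ ∣ y ∣) ⟨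
  2 ℕ.* ∣ y ∣                          ≤⟨ ℕ.*-monoˡ-≤ ∣ y ∣ (ℕ.*-monoʳ-≤ 2 (ℕ.n≢0⇒n>0 (k≢0 ∘ ℤ.∣i∣≡0⇒i≡0))) ⟩
  2 ℕ.* ∣ k ∣ ℕ.* ∣ y ∣                ≡⟨ ∣2*k*y∣ ⟨
  ∣ + 2 * k * y ∣                      ≡⟨ cong ∣_∣ (shifted-back x (+ 2 * k * y)) ⟨
  ∣ (x + + 2 * k * y) - x ∣            ≤⟨ ℤ.∣i-j∣≤∣i∣+∣j∣ (x + + 2 * k * y) x ⟩
  ∣ x + + 2 * k * y ∣ ℕ.+ ∣ x ∣        <⟨ ℕ.+-monoʳ-< ∣ x + + 2 * k * y ∣ ∣x∣<∣y∣ ⟩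
  ∣ x + + 2 * k * y ∣ ℕ.+ ∣ y ∣        ∎)
  where
  open ℕ.≤-Reasoning
  ∣2*k*y∣ : ∣ + 2 * k * y ∣ ≡ 2 ℕ.* ∣ k ∣ ℕ.* ∣ y ∣
  ∣2*k*y∣ = trans (ℤ.abs-* (+ 2 * k) y) (cong (ℕ._* ∣ y ∣) (ℤ.abs-* (+ 2) k))
  shifted-back : ∀ x t → (x + t) - x ≡ t
  shifted-back = solve-∀

shift-unique : ∀ {x y y′} k k′ → ∣ y ∣ ℕ.< ∣ x ∣ → ∣ y′ ∣ ℕ.< ∣ x ∣ →
               y + + 2 * k * x ≡ y′ + + 2 * k′ * x → k ≡ k′ × y ≡ y′
shift-unique {x} {y} {y′} k k′ ∣y∣<∣x∣ ∣y′∣<∣x∣ eq with k ℤ.≟ k′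
... | yes refl = refl , (begin
  y                          ≡⟨ cancel y (+ 2 * k * x) ⟨
  (y + + 2 * k * x) - + 2 * k * x   ≡⟨ cong (_- + 2 * k * x) eq ⟩
  (y′ + + 2 * k * x) - + 2 * k * x  ≡⟨ cancel y′ (+ 2 * k * x) ⟩
  y′                         ∎)
  where
  open ≡-Reasoning
  cancel : ∀ y t → (y + t) - t ≡ y
  cancel = solve-∀
... | no k≢k′ =
  ⊥-elim (ℕ.<-asym ∣y∣<∣x∣ (subst (λ t → ∣ x ∣ ℕ.< ∣ t ∣) (sym y≡) (shift-grows y′ x (k′ - k) ∣y′∣<∣x∣ k′-k≢0)))
  where
  y≡ : y ≡ y′ + + 2 * (k′ - k) * x
  y≡ = trans (move y k x) (trans (cong (_- + 2 * k * x) eq) (collect y′ k′ k x))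
    where
    move : ∀ y k x → y ≡ (y + + 2 * k * x) - + 2 * k * x
    move = solve-∀
    collect : ∀ y′ k′ k x → (y′ + + 2 * k′ * x) - + 2 * k * x ≡ y′ + + 2 * (k′ - k) * x
    collect = solve-∀
  k′-k≢0 : k′ - k ≢ 0ℤ
  k′-k≢0 = k≢k′ ∘ sym ∘ ℤ.i-j≡0⇒i≡j k′ k

nearest-shift⁺ : ∀ n y → ∃[ k ] ∣ y + + 2 * k * + suc n ∣ ℕ.≤ suc n
nearest-shift⁺ n y = choose (ℕ.≤-<-connex r m)
  where
  m = suc n
  q = y /ℕ (m ℕ.+ m)
  r = y %ℕ (m ℕ.+ m)
  y≡r+q2m : y ≡ + r + q * + (m ℕ.+ m)
  y≡r+q2m = a≡a%ℕn+[a/ℕn]*n y (m ℕ.+ m)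
  ∣r⊖2m∣≤m : m ℕ.< r → ∣ r ⊖ (m ℕ.+ m) ∣ ℕ.≤ m
  ∣r⊖2m∣≤m m<r = begin
    ∣ r ⊖ (m ℕ.+ m) ∣  ≡⟨ ℤ.∣⊖∣-< (n%ℕd<d y (m ℕ.+ m)) ⟩
    (m ℕ.+ m) ℕ.∸ r    ≤⟨ ℕ.∸-monoʳ-≤ (m ℕ.+ m) (ℕ.<⇒≤ m<r) ⟩
    (m ℕ.+ m) ℕ.∸ m    ≡⟨ ℕ.m+n∸n≡m m m ⟩
    m                  ∎
    where open ℕ.≤-Reasoning
  choose : r ℕ.≤ m ⊎ m ℕ.< r → ∃[ k ] ∣ y + + 2 * k * + m ∣ ℕ.≤ m
  choose (inj₁ r≤m) = - q , subst (λ t → ∣ t ∣ ℕ.≤ m) (sym (begin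
      y + + 2 * - q * + m                      ≡⟨ cong (λ t → t + + 2 * - q * + m) y≡r+q2m ⟩
      (+ r + q * (+ m + + m)) + + 2 * - q * + m  ≡⟨ cancel (+ r) q (+ m) ⟩
      + r                                      ∎)) r≤m
    where
    open ≡-Reasoning
    cancel : ∀ r q m → (r + q * (m + m)) + + 2 * - q * m ≡ r
    cancel = solve-∀
  choose (inj₂ m<r) = - (q + 1ℤ) , subst (λ t → ∣ t ∣ ℕ.≤ m) (sym (begin
      y + + 2 * - (q + 1ℤ) * + m                      ≡⟨ cong (λ t → t + + 2 * - (q + 1ℤ) * + m) y≡r+q2m ⟩
      (+ r + q * (+ m + + m)) + + 2 * - (q + 1ℤ) * + m  ≡⟨ cancel (+ r) q (+ m) ⟩
      + r - + (m ℕ.+ m)                               ≡⟨ ℤ.m-n≡m⊖n r (m ℕ.+ m) ⟩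
      r ⊖ (m ℕ.+ m)                                   ∎)) (∣r⊖2m∣≤m m<r)
    where
    open ≡-Reasoning
    cancel : ∀ r q m → (r + q * (m + m)) + + 2 * - (q + 1ℤ) * m ≡ r - (m + m)
    cancel = solve-∀

nearest-shift : ∀ x y → x ≢ 0ℤ → ∃[ k ] ∣ y + + 2 * k * x ∣ ℕ.≤ ∣ x ∣
nearest-shift (+ zero) y x≢0 = ⊥-elim (x≢0 refl)
nearest-shift (+ suc n) y _ = nearest-shift⁺ n y
nearest-shift -[1+ n ] y _ with nearest-shift⁺ n y
... | k , ∣y+2km∣≤m = - k , subst (λ t → ∣ t ∣ ℕ.≤ suc n) (flip-sign y k (+ suc n)) ∣y+2km∣≤m
  where
  flip-sign : ∀ y k m → y + + 2 * k * m ≡ y + + 2 * - k * - m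
  flip-sign = solve-∀

nearest-shift-strict : ∀ x y → x ≢ 0ℤ → OppositeParity x y → ∃[ k ] ∣ y + + 2 * k * x ∣ ℕ.< ∣ x ∣
nearest-shift-strict x y x≢0 opposite with nearest-shift x y x≢0
... | k , ≤∣x∣ = k , ℕ.≤∧≢⇒< ≤∣x∣ (shift-∣∣≢ opposite k)

-- Bottom rows

negPair : Pair → Pair
negPair (c , d) = (- c , - d)

negPair-involutive : ∀ p → negPair (negPair p) ≡ p
negPair-involutive (c , d) = cong₂ _,_ (ℤ.neg-involutive c) (ℤ.neg-involutive d)

open UpToSign {neg = negPair} negPair-involutive public using ()
  renaming (≈-sym to ≈±-sym; ≈-trans to ≈±-trans; ≈-setoid to ≈±-setoid)

module ≈±-Reasoning = SetoidReasoning ≈±-setoid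

bottom-cong : ∀ {M N} → M ≈P N → bottom M ≈± bottom N
bottom-cong = map-≈ negM negPair bottom (λ _ → refl)

_∣B_ : Pair → ℤ → Pair
(c , d) ∣B f = (c + + 2 * - f * d , d)

bottom-·A^ : ∀ X e → bottom (X · A^ e) ≡ bottom X ∣act e
bottom-·A^ (mat a b c d) e = cong₂ _,_ (first c d) (second c d e)
  where
  first : ∀ c d → c * 1ℤ + d * 0ℤ ≡ c
  first = solve-∀
  second : ∀ c d e → c * (+ 2 * e) + d * 1ℤ ≡ d + + 2 * e * c
  second = solve-∀

bottom-·B^ : ∀ X f → bottom (X · B^ f) ≡ bottom X ∣B f
bottom-·B^ (mat a b c d) f = cong₂ _,_ (first c d f) (second c d)
  where
  first : ∀ c d f → c * 1ℤ + d * (+ 2 * - f) ≡ c + + 2 * - f * d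
  first = solve-∀
  second : ∀ c d → c * 0ℤ + d * 1ℤ ≡ d
  second = solve-∀

rotate unrotate : Pair → Pair
rotate (c , d) = (d , - c)
unrotate (c , d) = (- d , c)

bottom-·S : ∀ X → bottom (X · S) ≡ rotate (bottom X)
bottom-·S (mat a b c d) = cong₂ _,_ (first c d) (second c d)
  where
  first : ∀ c d → c * 0ℤ + d * 1ℤ ≡ d
  first = solve-∀
  second : ∀ c d → c * - 1ℤ + d * 0ℤ ≡ - c
  second = solve-∀

rotate-cong : ∀ {p q} → p ≈± q → rotate p ≈± rotate q
rotate-cong = map-≈ negPair negPair rotate (λ _ → refl)

rotate-cancel : ∀ {p q} → rotate p ≈± rotate q → p ≈± q
rotate-cancel {p} {q} rp≈rq =
  subst₂ _≈±_ (unrotate-rotate p) (unrotate-rotate q) (map-≈ negPair negPair unrotate (λ _ → refl) rp≈rq)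
  where
  unrotate-rotate : ∀ p → unrotate (rotate p) ≡ p
  unrotate-rotate (c , d) = cong (_, d) (ℤ.neg-involutive c)

rotate-unrotate : ∀ p → rotate (unrotate p) ≡ p
rotate-unrotate (c , d) = cong (c ,_) (ℤ.neg-involutive d)

infixr 6 _⊙_

_⊙_ : ℤ → Pair → Pair
z ⊙ (c , d) = (z * c , z * d)

⊙-∣act : ∀ z p e → (z ⊙ p) ∣act e ≡ z ⊙ (p ∣act e)
⊙-∣act z (c , d) e = cong (z * c ,_) (distrib z c d e)
  where
  distrib : ∀ z c d e → z * d + + 2 * e * (z * c) ≡ z * (d + + 2 * e * c)
  distrib = solve-∀

⊙-∣B : ∀ z p f → (z ⊙ p) ∣B f ≡ z ⊙ (p ∣B f)
⊙-∣B z (c , d) f = cong (_, z * d) (distrib z c d f)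
  where
  distrib : ∀ z c d f → z * c + + 2 * - f * (z * d) ≡ z * (c + + 2 * - f * d)
  distrib = solve-∀

negPair-∣act : ∀ p e → negPair p ∣act e ≡ negPair (p ∣act e)
negPair-∣act (c , d) e = cong (- c ,_) (distrib c d e)
  where
  distrib : ∀ c d e → - d + + 2 * e * - c ≡ - (d + + 2 * e * c)
  distrib = solve-∀

negPair-∣B : ∀ p f → negPair p ∣B f ≡ negPair (p ∣B f)
negPair-∣B (c , d) f = cong (_, - d) (distrib c d f)
  where
  distrib : ∀ c d f → - c + + 2 * - f * - d ≡ - (c + + 2 * - f * d)
  distrib = solve-∀

EvenOdd : Pair → Set
EvenOdd (c , d) = Even c × Odd d

Even-cong : ∀ {x y} → x ≈[ -_ ] y → Even y → Even x
Even-cong (inj₁ refl) = id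
Even-cong (inj₂ refl) = Even-neg

Odd-cong : ∀ {x y} → x ≈[ -_ ] y → Odd y → Odd x
Odd-cong (inj₁ refl) = id
Odd-cong (inj₂ refl) = Odd-neg

proj₁-cong : ∀ {p q} → p ≈± q → proj₁ p ≈[ -_ ] proj₁ q
proj₁-cong = map-≈ negPair -_ proj₁ (λ _ → refl)

proj₂-cong : ∀ {p q} → p ≈± q → proj₂ p ≈[ -_ ] proj₂ q
proj₂-cong = map-≈ negPair -_ proj₂ (λ _ → refl)

FirstLarger SecondLarger : Pair → Set
FirstLarger (c , d) = ∣ d ∣ ℕ.< ∣ c ∣
SecondLarger (c , d) = ∣ c ∣ ℕ.< ∣ d ∣

FirstLarger-neg : ∀ p → FirstLarger p → FirstLarger (negPair p)
FirstLarger-neg (c , d) = subst₂ ℕ._<_ (sym (ℤ.∣-i∣≡∣i∣ d)) (sym (ℤ.∣-i∣≡∣i∣ c))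

SecondLarger-neg : ∀ p → SecondLarger p → SecondLarger (negPair p)
SecondLarger-neg (c , d) = subst₂ ℕ._<_ (sym (ℤ.∣-i∣≡∣i∣ c)) (sym (ℤ.∣-i∣≡∣i∣ d))

SecondLarger-⊙⁻¹ : ∀ z {p} → SecondLarger (z ⊙ p) → SecondLarger p
SecondLarger-⊙⁻¹ z {c , d} = ℕ.*-cancelˡ-< (∣ z ∣) _ _ ∘ subst₂ ℕ._<_ (ℤ.abs-* z c) (ℤ.abs-* z d)

zero-cong : ∀ {x y} → x ≈[ -_ ] y → x ≡ 0ℤ → y ≡ 0ℤ
zero-cong (inj₁ refl) = id
zero-cong (inj₂ refl) = ℤ.neg-injective

FirstLarger⇒proj₁≢0 : ∀ p → FirstLarger p → proj₁ p ≢ 0ℤ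
FirstLarger⇒proj₁≢0 _ ∣d∣<∣c∣ refl = ℕ.n≮0 ∣d∣<∣c∣

neg≢0 : ∀ {f} → f ≢ 0ℤ → - f ≢ 0ℤ
neg≢0 f≢0 = f≢0 ∘ ℤ.neg-injective

∣B-FirstLarger : ∀ p f → SecondLarger p → f ≢ 0ℤ → FirstLarger (p ∣B f)
∣B-FirstLarger (c , d) f ∣c∣<∣d∣ f≢0 = shift-grows c d (- f) ∣c∣<∣d∣ (neg≢0 f≢0)

∣act-SecondLarger : ∀ p e → FirstLarger p → e ≢ 0ℤ → SecondLarger (p ∣act e)
∣act-SecondLarger (c , d) e ∣d∣<∣c∣ e≢0 = shift-grows d c e ∣d∣<∣c∣ e≢0

peel-A : ∀ {u u′} e e′ → FirstLarger u → FirstLarger u′ → u ∣act e ≡ u′ ∣act e′ → e ≡ e′ × u ≡ u′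
peel-A {c , d} {c′ , d′} e e′ ∣d∣<∣c∣ ∣d′∣<∣c′∣ eq with ,-injectiveˡ eq
... | refl with shift-unique {c} {d} {d′} e e′ ∣d∣<∣c∣ ∣d′∣<∣c′∣ (,-injectiveʳ eq)
... | refl , refl = refl , refl

peel-B : ∀ {v v′} f f′ → SecondLarger v → SecondLarger v′ → v ∣B f ≡ v′ ∣B f′ → f ≡ f′ × v ≡ v′
peel-B {c , d} {c′ , d′} f f′ ∣c∣<∣d∣ ∣c′∣<∣d′∣ eq with ,-injectiveʳ eq
... | refl with shift-unique {d} {c} {c′} (- f) (- f′) ∣c∣<∣d∣ ∣c′∣<∣d′∣ (,-injectiveˡ eq)
... | -f≡-f′ , refl = ℤ.neg-injective -f≡-f′ , refl

peel-A-≈± : ∀ {u u′} e e′ → FirstLarger u → FirstLarger u′ →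
            (u ∣act e) ≈± (u′ ∣act e′) → e ≡ e′ × u ≈± u′
peel-A-≈± e e′ large large′ (inj₁ eq) = map₂ inj₁ (peel-A e e′ large large′ eq)
peel-A-≈± {u′ = u′} e e′ large large′ (inj₂ eq) =
  map₂ inj₂ (peel-A e e′ large (FirstLarger-neg u′ large′) (trans eq (sym (negPair-∣act u′ e′))))

peel-B-≈± : ∀ {v v′} f f′ → SecondLarger v → SecondLarger v′ →
            (v ∣B f) ≈± (v′ ∣B f′) → f ≡ f′ × v ≈± v′
peel-B-≈± f f′ large large′ (inj₁ eq) = map₂ inj₁ (peel-B f f′ large large′ eq)
peel-B-≈± {v′ = v′} f f′ large large′ (inj₂ eq) =
  map₂ inj₂ (peel-B f f′ large (SecondLarger-neg v′ large′) (trans eq (sym (negPair-∣B v′ f′))))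

-- Reduced words

-- Words are built from the right, s ▷ (f , e) standing for s · B^f A^e: the ping-pong
-- argument peels letters off the right end.
infixl 5 _▷_

data Word : Set where
  [] : Word
  _▷_ : Word → ℤ × ℤ → Word

eval : Word → Mat
eval [] = I
eval (s ▷ (f , e)) = eval s · B^ f · A^ e

row : Word → Pair
row [] = (0ℤ , 1ℤ)
row (s ▷ (f , e)) = (row s ∣B f) ∣act e

Alternating : Word → Set
Alternating [] = ⊤
Alternating (s ▷ (f , e)) = Alternating s × f ≢ 0ℤ × e ≢ 0ℤ

-- The empty word is Reduced: it accounts for S̄ ∈ 𝓑̃; for 𝓑 one adds s ≢ [].
Reduced : Word → Set
Reduced [] = ⊤
Reduced (s ▷ (f , e)) = Alternating s × f ≢ 0ℤ

Alternating⇒Reduced : ∀ s → Alternating s → Reduced s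
Alternating⇒Reduced [] _ = tt
Alternating⇒Reduced (s ▷ _) (alt , f≢0 , _) = alt , f≢0

bottom-eval : ∀ s → bottom (eval s) ≡ row s
bottom-eval [] = refl
bottom-eval (s ▷ (f , e)) = begin
  bottom (eval s · B^ f · A^ e)    ≡⟨ bottom-·A^ (eval s · B^ f) e ⟩
  bottom (eval s · B^ f) ∣act e    ≡⟨ cong (_∣act e) (bottom-·B^ (eval s) f) ⟩
  (bottom (eval s) ∣B f) ∣act e    ≡⟨ cong (λ p → (p ∣B f) ∣act e) (bottom-eval s) ⟩
  (row s ∣B f) ∣act e              ∎
  where open ≡-Reasoning

det-eval : ∀ s → det (eval s) ≡ 1ℤ
det-eval [] = refl
det-eval (s ▷ (f , e)) = begin
  det (eval s · B^ f · A^ e)             ≡⟨ det-· (eval s · B^ f) (A^ e) ⟩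
  det (eval s · B^ f) * det (A^ e)       ≡⟨ cong₂ _*_ (det-· (eval s) (B^ f)) (det-A^ e) ⟩
  det (eval s) * det (B^ f) * 1ℤ         ≡⟨ cong (λ t → t * det (B^ f) * 1ℤ) (det-eval s) ⟩
  1ℤ * det (B^ f) * 1ℤ                   ≡⟨ cong (λ t → 1ℤ * t * 1ℤ) (det-B^ f) ⟩
  1ℤ                                     ∎
  where open ≡-Reasoning

row-EvenOdd : ∀ s → EvenOdd (row s)
row-EvenOdd [] = Even-0 , Odd-1
row-EvenOdd (s ▷ (f , e)) with row s | row-EvenOdd s
... | c , d | even-c , odd-d = Even-shift (- f) d even-c , Odd-shift e (c + + 2 * - f * d) odd-d

row-SecondLarger : ∀ s → Alternating s → SecondLarger (row s)
row-SecondLarger [] _ = ℕ.s≤s ℕ.z≤n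
row-SecondLarger (s ▷ (f , e)) (alt , f≢0 , e≢0) =
  ∣act-SecondLarger (row s ∣B f) e (∣B-FirstLarger (row s) f (row-SecondLarger s alt) f≢0) e≢0

row-∣B-FirstLarger : ∀ s f → Alternating s → f ≢ 0ℤ → FirstLarger (row s ∣B f)
row-∣B-FirstLarger s f alt f≢0 = ∣B-FirstLarger (row s) f (row-SecondLarger s alt) f≢0

row-injective : ∀ s s′ → Reduced s → Reduced s′ → row s ≈± row s′ → s ≡ s′
row-injective [] [] _ _ _ = refl
row-injective [] (s′ ▷ (f′ , e′)) _ (alt′ , f′≢0) eq =
  ⊥-elim (FirstLarger⇒proj₁≢0 (row s′ ∣B f′) (row-∣B-FirstLarger s′ f′ alt′ f′≢0)
                              (zero-cong (proj₁-cong eq) refl))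
row-injective (s ▷ (f , e)) [] (alt , f≢0) _ eq =
  ⊥-elim (FirstLarger⇒proj₁≢0 (row s ∣B f) (row-∣B-FirstLarger s f alt f≢0)
                              (zero-cong (proj₁-cong (≈±-sym eq)) refl))
row-injective (s ▷ (f , e)) (s′ ▷ (f′ , e′)) (alt , f≢0) (alt′ , f′≢0) eq
  with peel-A-≈± e e′ (row-∣B-FirstLarger s f alt f≢0) (row-∣B-FirstLarger s′ f′ alt′ f′≢0) eq
... | refl , eq₁ with peel-B-≈± f f′ (row-SecondLarger s alt) (row-SecondLarger s′ alt′) eq₁
... | refl , eq₂ =
  cong (_▷ (f , e)) (row-injective s s′ (Alternating⇒Reduced s alt) (Alternating⇒Reduced s′ alt′) eq₂)

Reduced∧SecondLarger⇒Alternating : ∀ s → Reduced s → SecondLarger (row s) → Alternating s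
Reduced∧SecondLarger⇒Alternating [] _ _ = tt
Reduced∧SecondLarger⇒Alternating (s ▷ (f , e)) (alt , f≢0) second = alt , f≢0 , e≢0
  where
  e≢0 : e ≢ 0ℤ
  e≢0 refl = ℕ.<-asym (row-∣B-FirstLarger s f alt f≢0)
    (subst (λ t → ∣ proj₁ (row s ∣B f) ∣ ℕ.< ∣ t ∣) (ℤ.+-identityʳ (proj₂ (row s ∣B f))) second)

shift-into-range : ∀ x y → x ≢ 0ℤ → OppositeParity x y →
                   ∃[ k ] ∃[ y₀ ] ∣ y₀ ∣ ℕ.< ∣ x ∣ × y ≡ y₀ + + 2 * k * x
shift-into-range x y x≢0 opposite with nearest-shift-strict x y x≢0 opposite
... | k , ∣y₀∣<∣x∣ = - k , y + + 2 * k * x , ∣y₀∣<∣x∣ , shift-back y k x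
  where
  shift-back : ∀ y k x → y ≡ (y + + 2 * k * x) + + 2 * - k * x
  shift-back = solve-∀

-- z is the last remainder, reached when c = 0; coprimality of (c , d) then forces z = ±1.
row-multiple : ∀ n c d → ∣ c ∣ ℕ.< n → Even c → Odd d → ∃[ s ] Reduced s × ∃[ z ] (c , d) ≡ z ⊙ row s
row-multiple n c d _ _ _ with c ℤ.≟ 0ℤ
row-multiple n c d _ _ _ | yes refl = [] , tt , d , cong₂ _,_ (sym (ℤ.*-zeroʳ d)) (sym (ℤ.*-identityʳ d))
row-multiple (suc n) c d ∣c∣<1+n even-c odd-d | no c≢0
  with shift-into-range c d c≢0 (inj₁ (even-c , odd-d))
... | e , d₀ , ∣d₀∣<∣c∣ , d≡d₀+2ec
  with odd-d₀ ← Odd-shift⁻ e c (subst Odd d≡d₀+2ec odd-d)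
  with shift-into-range d₀ c (Odd⇒≢0 odd-d₀) (inj₂ (odd-d₀ , even-c))
... | k , c₀ , ∣c₀∣<∣d₀∣ , c≡c₀+2kd₀
  with row-multiple n c₀ d₀ (ℕ.<-≤-trans (ℕ.<-trans ∣c₀∣<∣d₀∣ ∣d₀∣<∣c∣) (ℕ.s≤s⁻¹ ∣c∣<1+n))
              (Even-shift⁻ k d₀ (subst Even c≡c₀+2kd₀ even-c)) odd-d₀
... | t , reduced-t , z , c₀d₀≡z⊙t = t ▷ (- k , e) , (alternating-t , neg≢0 k≢0) , z , c,d≡z⊙row
  where
  alternating-t : Alternating t
  alternating-t = Reduced∧SecondLarger⇒Alternating t reduced-t
                    (SecondLarger-⊙⁻¹ z (subst SecondLarger c₀d₀≡z⊙t ∣c₀∣<∣d₀∣))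
  k≢0 : k ≢ 0ℤ
  k≢0 refl = ℕ.<-asym ∣d₀∣<∣c∣
    (subst (λ x → ∣ x ∣ ℕ.< ∣ d₀ ∣) (trans (sym (ℤ.+-identityʳ c₀)) (sym c≡c₀+2kd₀)) ∣c₀∣<∣d₀∣)
  c,d₀≡ : (c , d₀) ≡ (c₀ , d₀) ∣B (- k)
  c,d₀≡ = cong (_, d₀) (trans c≡c₀+2kd₀ (cong (λ j → c₀ + + 2 * j * d₀) (sym (ℤ.neg-involutive k))))
  c,d≡z⊙row : (c , d) ≡ z ⊙ ((row t ∣B (- k)) ∣act e)
  c,d≡z⊙row = begin
    (c , d)                          ≡⟨ cong (c ,_) d≡d₀+2ec ⟩
    (c , d₀) ∣act e                  ≡⟨ cong (_∣act e) c,d₀≡ ⟩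
    ((c₀ , d₀) ∣B (- k)) ∣act e      ≡⟨ cong (λ p → (p ∣B (- k)) ∣act e) c₀d₀≡z⊙t ⟩
    ((z ⊙ row t) ∣B (- k)) ∣act e    ≡⟨ cong (_∣act e) (⊙-∣B z (row t) (- k)) ⟩
    (z ⊙ (row t ∣B (- k))) ∣act e    ≡⟨ ⊙-∣act z (row t ∣B (- k)) e ⟩
    z ⊙ ((row t ∣B (- k)) ∣act e)    ∎
    where open ≡-Reasoning

coprime-multiple⇒≈± : ∀ {c d} z p → gcd c d ≡ 1ℤ → (c , d) ≡ z ⊙ p → (c , d) ≈± p
coprime-multiple⇒≈± {c} {d} z (c′ , d′) gcd≡1 eq with ∣i∣≡∣j∣⇒i≡±j z 1ℤ (ℕ∣.∣1⇒≡1 z∣1)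
  where
  z∣c : z ∣ c
  z∣c = divides c′ (trans (,-injectiveˡ eq) (ℤ.*-comm z c′))
  z∣d : z ∣ d
  z∣d = divides d′ (trans (,-injectiveʳ eq) (ℤ.*-comm z d′))
  z∣1 : ∣ z ∣ ℕ∣.∣ 1
  z∣1 = subst (λ g → ∣ z ∣ ℕ∣.∣ ∣ g ∣) gcd≡1 (gcd-greatest {c} {d} {z} (∣⇒∣ᵤ z∣c) (∣⇒∣ᵤ z∣d))
... | inj₁ refl = inj₁ (trans eq (cong₂ _,_ (ℤ.*-identityˡ c′) (ℤ.*-identityˡ d′)))
... | inj₂ refl = inj₂ (trans eq (cong₂ _,_ (-1* c′) (-1* d′)))
  where
  -1* : ∀ x → - 1ℤ * x ≡ - x
  -1* = solve-∀

row-surjective : ∀ c d → gcd c d ≡ 1ℤ → Even c → Odd d → ∃[ s ] Reduced s × (c , d) ≈± row s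
row-surjective c d gcd≡1 even-c odd-d with row-multiple (suc ∣ c ∣) c d (ℕ.n<1+n ∣ c ∣) even-c odd-d
... | s , reduced , z , eq = s , reduced , coprime-multiple⇒≈± z (row s) gcd≡1 eq

toWord : BWord → Word → Word
toWord (lastW f e _) acc = acc ▷ (f , e)
toWord (consW f e _ _ w) acc = toWord w (acc ▷ (f , e))

toWord-reduced : ∀ w acc → Alternating acc → Reduced (toWord w acc)
toWord-reduced (lastW f e f≢0) acc alt = alt , f≢0
toWord-reduced (consW f e f≢0 e≢0 w) acc alt = toWord-reduced w (acc ▷ (f , e)) (alt , f≢0 , e≢0)

toWord-nonempty : ∀ w acc → toWord w acc ≢ []
toWord-nonempty (lastW _ _ _) acc ()
toWord-nonempty (consW f e _ _ w) acc = toWord-nonempty w (acc ▷ (f , e))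

toWord-eval : ∀ w acc → eval (toWord w acc) ≈P (eval acc · evalW w)
toWord-eval (lastW f e _) acc = begin
  eval acc · B^ f · A^ e                  ≡⟨ ·-assoc (eval acc) (B^ f) (A^ e) ⟩
  eval acc · (B^ f · A^ e)                ≈⟨ ·-congʳ (eval acc) (≈P-sym (block-≈ f e)) ⟩
  eval acc · ((Bm ^ℤ f) · (Am ^ℤ e))      ∎
  where open ≈P-Reasoning
toWord-eval (consW f e _ _ w) acc = begin
  eval (toWord w (acc ▷ (f , e)))                 ≈⟨ toWord-eval w (acc ▷ (f , e)) ⟩
  eval acc · B^ f · A^ e · evalW w                ≡⟨ ·-assoc₄ (eval acc) (B^ f) (A^ e) (evalW w) ⟩
  eval acc · (B^ f · A^ e · evalW w)              ≈⟨ ·-congʳ (eval acc) (·-congˡ (evalW w) (≈P-sym (block-≈ f e))) ⟩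
  eval acc · ((Bm ^ℤ f) · (Am ^ℤ e) · evalW w)    ∎
  where open ≈P-Reasoning

fromWord : (s : Word) → Alternating s → BWord → BWord
fromWord [] _ w = w
fromWord (s ▷ (f , e)) (alt , f≢0 , e≢0) w = fromWord s alt (consW f e f≢0 e≢0 w)

fromWord-eval : ∀ s alt w → evalW (fromWord s alt w) ≈P (eval s · evalW w)
fromWord-eval [] _ w = inj₁ (sym (·-identityˡ (evalW w)))
fromWord-eval (s ▷ (f , e)) (alt , f≢0 , e≢0) w = begin
  evalW (fromWord s alt (consW f e f≢0 e≢0 w))    ≈⟨ fromWord-eval s alt (consW f e f≢0 e≢0 w) ⟩
  eval s · ((Bm ^ℤ f) · (Am ^ℤ e) · evalW w)      ≈⟨ ·-congʳ (eval s) (·-congˡ (evalW w) (block-≈ f e)) ⟩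
  eval s · (B^ f · A^ e · evalW w)                ≡⟨ ·-assoc₄ (eval s) (B^ f) (A^ e) (evalW w) ⟨
  eval s · B^ f · A^ e · evalW w                  ∎
  where open ≈P-Reasoning

InB⇒reduced : ∀ {M} → InB M → ∃[ s ] Reduced s × s ≢ [] × M ≈P eval s
InB⇒reduced {M} (w , M≈w) = toWord w [] , toWord-reduced w [] tt , toWord-nonempty w [] , (begin
  M                    ≈⟨ M≈w ⟩
  evalW w              ≡⟨ ·-identityˡ (evalW w) ⟨
  I · evalW w          ≈⟨ ≈P-sym (toWord-eval w []) ⟩
  eval (toWord w [])   ∎)
  where open ≈P-Reasoning

reduced⇒InB : ∀ {M} s → Reduced s → s ≢ [] → M ≈P eval s → InB M
reduced⇒InB [] _ []≢[] _ = ⊥-elim ([]≢[] refl)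
reduced⇒InB {M} (s ▷ (f , e)) (alt , f≢0) _ M≈s = fromWord s alt (lastW f e f≢0) , (begin
  M                                          ≈⟨ M≈s ⟩
  eval s · B^ f · A^ e                       ≡⟨ ·-assoc (eval s) (B^ f) (A^ e) ⟩
  eval s · (B^ f · A^ e)                     ≈⟨ ·-congʳ (eval s) (≈P-sym (block-≈ f e)) ⟩
  eval s · evalW (lastW f e f≢0)             ≈⟨ ≈P-sym (fromWord-eval s alt (lastW f e f≢0)) ⟩
  evalW (fromWord s alt (lastW f e f≢0))     ∎)
  where open ≈P-Reasoning

InBt⇒reduced : ∀ {M} → InBt M → ∃[ s ] Reduced s × M ≈P (eval s · S)
InBt⇒reduced (inj₁ (w , M≈wS)) with InB⇒reduced (w , inj₁ refl)
... | s , reduced , _ , w≈s = s , reduced , ≈P-trans M≈wS (·-congˡ S w≈s)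
InBt⇒reduced (inj₂ M≈S) = [] , tt , ≈P-trans M≈S (inj₁ (sym (·-identityˡ S)))

reduced⇒InBt : ∀ {M} s → Reduced s → M ≈P (eval s · S) → InBt M
reduced⇒InBt [] _ M≈S = inj₂ (≈P-trans M≈S (inj₁ (·-identityˡ S)))
reduced⇒InBt (s ▷ fe) reduced M≈sS with reduced⇒InB (s ▷ fe) reduced (λ ()) (inj₁ refl)
... | w , s≈w = inj₁ (w , ≈P-trans M≈sS (·-congˡ S s≈w))

eval-▷-·A^ : ∀ s f e ℓ → eval (s ▷ (f , e)) · A^ ℓ ≡ eval (s ▷ (f , e + ℓ))
eval-▷-·A^ s f e ℓ = trans (·-assoc (eval s · B^ f) (A^ e) (A^ ℓ)) (cong (eval s · B^ f ·_) (A^-+ e ℓ))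

append-B^ : ∀ s ℓ → Alternating s → ∃[ s′ ] Reduced s′ × eval s · B^ ℓ ≡ eval s′
append-B^ s ℓ alt with ℓ ℤ.≟ 0ℤ
... | yes refl = s , Alternating⇒Reduced s alt , ·-identityʳ (eval s)
... | no ℓ≢0 = s ▷ (ℓ , 0ℤ) , (alt , ℓ≢0) , sym (·-identityʳ (eval s · B^ ℓ))

absorb-B^ : ∀ s ℓ → Reduced s → ∃[ s′ ] Reduced s′ × eval s · B^ ℓ ≡ eval s′
absorb-B^ [] ℓ _ = append-B^ [] ℓ tt
absorb-B^ (s ▷ (f , e)) ℓ (alt , f≢0) with e ℤ.≟ 0ℤ
... | no e≢0 = append-B^ (s ▷ (f , e)) ℓ (alt , f≢0 , e≢0)
... | yes refl with append-B^ s (f + ℓ) alt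
...   | s′ , reduced′ , eq = s′ , reduced′ , (begin
  eval s · B^ f · I · B^ ℓ       ≡⟨ cong (_· B^ ℓ) (·-identityʳ (eval s · B^ f)) ⟩
  eval s · B^ f · B^ ℓ           ≡⟨ ·-assoc (eval s) (B^ f) (B^ ℓ) ⟩
  eval s · (B^ f · B^ ℓ)         ≡⟨ cong (eval s ·_) (B^-+ f ℓ) ⟩
  eval s · B^ (f + ℓ)            ≡⟨ eq ⟩
  eval s′                        ∎)
  where open ≡-Reasoning

InB-·Am^ℤ : ∀ M ℓ → InB M → InB (M · (Am ^ℤ ℓ))
InB-·Am^ℤ M ℓ inB with InB⇒reduced inB
... | [] , _ , []≢[] , _ = ⊥-elim ([]≢[] refl)
... | s ▷ (f , e) , reduced , _ , M≈s = reduced⇒InB (s ▷ (f , e + ℓ)) reduced (λ ()) (begin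
  M · (Am ^ℤ ℓ)                  ≡⟨ cong (M ·_) (Am^ℤ≡A^ ℓ) ⟩
  M · A^ ℓ                       ≈⟨ ·-congˡ (A^ ℓ) M≈s ⟩
  eval (s ▷ (f , e)) · A^ ℓ      ≡⟨ eval-▷-·A^ s f e ℓ ⟩
  eval (s ▷ (f , e + ℓ))         ∎)
  where open ≈P-Reasoning

InBt-·Am^ℤ : ∀ M ℓ → InBt M → InBt (M · (Am ^ℤ ℓ))
InBt-·Am^ℤ M ℓ inBt with InBt⇒reduced inBt
... | s , reduced , M≈sS with absorb-B^ s ℓ reduced
...   | s′ , reduced′ , eq = reduced⇒InBt s′ reduced′ (begin
  M · (Am ^ℤ ℓ)                  ≡⟨ cong (M ·_) (Am^ℤ≡A^ ℓ) ⟩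
  M · A^ ℓ                       ≈⟨ ·-congˡ (A^ ℓ) M≈sS ⟩
  eval s · S · A^ ℓ              ≡⟨ ·-assoc (eval s) S (A^ ℓ) ⟩
  eval s · (S · A^ ℓ)            ≡⟨ cong (eval s ·_) (S·A^≡B^·S ℓ) ⟩
  eval s · (B^ ℓ · S)            ≡⟨ ·-assoc (eval s) (B^ ℓ) S ⟨
  eval s · B^ ℓ · S              ≡⟨ cong (_· S) eq ⟩
  eval s′ · S                    ∎)
  where open ≈P-Reasoning

bottom-·Am^ℤ : ∀ M ℓ → bottom (M · (Am ^ℤ ℓ)) ≡ bottom M ∣act ℓ
bottom-·Am^ℤ M ℓ = trans (cong (λ X → bottom (M · X)) (Am^ℤ≡A^ ℓ)) (bottom-·A^ M ℓ)

bottom≈row : ∀ {M} s → M ≈P eval s → bottom M ≈± row s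
bottom≈row s M≈s = ≈±-trans (bottom-cong M≈s) (inj₁ (bottom-eval s))

bottom≈rotate-row : ∀ {M} s → M ≈P (eval s · S) → bottom M ≈± rotate (row s)
bottom≈rotate-row s M≈sS =
  ≈±-trans (bottom-cong M≈sS) (inj₁ (trans (bottom-·S (eval s)) (cong rotate (bottom-eval s))))

det-eval·S : ∀ s → det (eval s · S) ≡ 1ℤ
det-eval·S s = trans (det-· (eval s) S) (cong (_* 1ℤ) (det-eval s))

InB⇒InP-bottom : ∀ M → InB M → InP (bottom M)
InB⇒InP-bottom M inB with InB⇒reduced inB
... | [] , _ , []≢[] , _ = ⊥-elim ([]≢[] refl)
... | s ▷ (f , e) , (alt , f≢0) , _ , M≈s =
  det≡1⇒gcd[c,d]≡1 M (trans (det-cong M≈s) (det-eval (s ▷ (f , e)))) ,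
  ∣⇒∣ᵤ (Even-cong (proj₁-cong M~s) (proj₁ (row-EvenOdd (s ▷ (f , e))))) ,
  Odd-cong (proj₂-cong M~s) (proj₂ (row-EvenOdd (s ▷ (f , e)))) ∘ ∣ᵤ⇒∣ ,
  FirstLarger⇒proj₁≢0 (row s ∣B f) (row-∣B-FirstLarger s f alt f≢0) ∘ zero-cong (proj₁-cong M~s)
  where
  M~s : bottom M ≈± row (s ▷ (f , e))
  M~s = bottom≈row (s ▷ (f , e)) M≈s

InBt⇒InPt-bottom : ∀ M → InBt M → InPt (bottom M)
InBt⇒InPt-bottom M inBt with InBt⇒reduced inBt
... | s , _ , M≈sS =
  det≡1⇒gcd[c,d]≡1 M (trans (det-cong M≈sS) (det-eval·S s)) ,
  Odd-cong (proj₁-cong M~s) (proj₂ (row-EvenOdd s)) ∘ ∣ᵤ⇒∣ ,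
  ∣⇒∣ᵤ (Even-cong (proj₂-cong M~s) (Even-neg (proj₁ (row-EvenOdd s))))
  where
  M~s : bottom M ≈± rotate (row s)
  M~s = bottom≈rotate-row s M≈sS

bottom-injective-InB : ∀ M N → InB M → InB N → bottom M ≈± bottom N → M ≈P N
bottom-injective-InB M N inB-M inB-N M~N with InB⇒reduced inB-M | InB⇒reduced inB-N
... | s , reduced , _ , M≈s | s′ , reduced′ , _ , N≈s′
  with refl ← row-injective s s′ reduced reduced′
                (≈±-trans (≈±-sym (bottom≈row s M≈s)) (≈±-trans M~N (bottom≈row s′ N≈s′)))
  = ≈P-trans M≈s (≈P-sym N≈s′)

bottom-injective-InBt : ∀ M N → InBt M → InBt N → bottom M ≈± bottom N → M ≈P N
bottom-injective-InBt M N inBt-M inBt-N M~N with InBt⇒reduced inBt-M | InBt⇒reduced inBt-N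
... | s , reduced , M≈sS | s′ , reduced′ , N≈s′S
  with refl ← row-injective s s′ reduced reduced′
                (rotate-cancel (≈±-trans (≈±-sym (bottom≈rotate-row s M≈sS))
                                         (≈±-trans M~N (bottom≈rotate-row s′ N≈s′S))))
  = ≈P-trans M≈sS (≈P-sym N≈s′S)

bottom-surjective-InB : ∀ p → InP p → Σ Mat λ M → InB M × bottom M ≈± p
bottom-surjective-InB (c , d) (gcd≡1 , 2∣c , 2∤d , c≢0)
  with row-surjective c d gcd≡1 (∣ᵤ⇒∣ 2∣c) (2∤d ∘ ∣⇒∣ᵤ)
... | s , reduced , cd~s =
  eval s , reduced⇒InB s reduced s≢[] (inj₁ refl) , ≈±-sym (≈±-trans cd~s (inj₁ (sym (bottom-eval s))))
  where
  s≢[] : s ≢ []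
  s≢[] refl = c≢0 (zero-cong (proj₁-cong (≈±-sym cd~s)) refl)

bottom-surjective-InBt : ∀ p → InPt p → Σ Mat λ M → InBt M × bottom M ≈± p
bottom-surjective-InBt (c , d) (gcd≡1 , 2∤c , 2∣d)
  with row-surjective (- d) c gcd[-d,c]≡1 (Even-neg (∣ᵤ⇒∣ 2∣d)) (2∤c ∘ ∣⇒∣ᵤ)
  where
  gcd[-d,c]≡1 : gcd (- d) c ≡ 1ℤ
  gcd[-d,c]≡1 = trans (gcd-comm (- d) c) (trans (cong (λ n → + ℕ.gcd ∣ c ∣ n) (ℤ.∣-i∣≡∣i∣ d)) gcd≡1)
... | s , reduced , -dc~s = eval s · S , reduced⇒InBt s reduced (inj₁ refl) , (begin
  bottom (eval s · S)      ≡⟨ bottom-·S (eval s) ⟩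
  rotate (bottom (eval s)) ≡⟨ cong rotate (bottom-eval s) ⟩
  rotate (row s)           ≈⟨ rotate-cong (≈±-sym -dc~s) ⟩
  rotate (- d , c)         ≡⟨ rotate-unrotate (c , d) ⟩
  (c , d)                  ∎)
  where open ≈±-Reasoning

lemma5p2 :
    -- (i) right multiplication by A^ℓ preserves 𝓑 and 𝓑̃
    ((M : Mat) (ℓ : ℤ) → InB M → InB (M · (Am ^ℤ ℓ)))
    × ((M : Mat) (ℓ : ℤ) → InBt M → InBt (M · (Am ^ℤ ℓ)))
    -- (ii) 𝓑 → 𝓟/ℤ^× : well defined, lands in 𝓟, injective, surjective, ℤ-equivariant
    × ((M N : Mat) → InB M → InB N → M ≈P N → bottom M ≈± bottom N)
    × ((M : Mat) → InB M → InP (bottom M))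
    × ((M N : Mat) → InB M → InB N → bottom M ≈± bottom N → M ≈P N)
    × ((p : Pair) → InP p → Σ Mat λ M → InB M × (bottom M ≈± p))
    × ((M : Mat) (ℓ : ℤ) → InB M → bottom (M · (Am ^ℤ ℓ)) ≈± (bottom M ∣act ℓ))
    -- (ii) 𝓑̃ → 𝓟̃/ℤ^× : the same properties
    × ((M N : Mat) → InBt M → InBt N → M ≈P N → bottom M ≈± bottom N)
    × ((M : Mat) → InBt M → InPt (bottom M))
    × ((M N : Mat) → InBt M → InBt N → bottom M ≈± bottom N → M ≈P N)
    × ((p : Pair) → InPt p → Σ Mat λ M → InBt M × (bottom M ≈± p))
    × ((M : Mat) (ℓ : ℤ) → InBt M → bottom (M · (Am ^ℤ ℓ)) ≈± (bottom M ∣act ℓ))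
lemma5p2 =
  InB-·Am^ℤ , InBt-·Am^ℤ ,
  (λ _ _ _ _ → bottom-cong) , InB⇒InP-bottom , bottom-injective-InB , bottom-surjective-InB ,
  (λ M ℓ _ → inj₁ (bottom-·Am^ℤ M ℓ)) ,
  (λ _ _ _ _ → bottom-cong) , InBt⇒InPt-bottom , bottom-injective-InBt , bottom-surjective-InBt ,
  (λ M ℓ _ → inj₁ (bottom-·Am^ℤ M ℓ))
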